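{- Let $1\le a_1\le a_2\le\cdots\le a_n\le n$ be a nondecreasing sequence of integers with exactly one index $f$ such that $a_f=f$. Define $a'_y=a_y-y$ for $y\le f$ and $a'_z=z-a_z$ for $f<z\le n$. Let $X=\{a_1,\dots,a_n\}$ be the set of the $n$ entries, regarded as distinct elements indexed by position. Define relations $S$ and $R$ on $X$ to consist exactly of the following pairs, for indices $i,j$: (a) If $i,j\le f$: $a_iSa_j$ when $i<j$, $a'_i>a'_j$ and $j=\min\{k: i<k\le f,\ a'_k=a'_j\}$; $a_iRa_j$ when $i<j$ and either ($a'_i>a'_j$ and there exists $w$ with $i<w<j$ and $a'_w=a'_j$) or $a'_i\le a'_j$. (b) If $i\le f<j$: $a_iRa_j$. (c) If $i,j>f$: $a_jSa_i$ when $i<j$, $a'_i<a'_j$ and $i=\max\{k: f<k<j,\ a'_k=a'_i\}$; $a_iRa_j$ when $i<j$ and either ($a'_i<a'_j$ and there exists $w$ with $i<w<j$ and $a'_w=a'_i$) or $a'_i\ge a'_j$. Then $(S,R)$ is a Catalan pair on $X$.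
   Context: For a set $X$, let $\mathcal{D}=\{(x,x): x\in X\}$, and for a relation $\theta$ let $\overline{\theta}=\theta\cup\theta^{ -1}$. An ordered pair $(S,R)$ of binary relations on a finite set $X$ is a Catalan pair on $X$ if: (i) $S$ and $R$ are irreflexive and transitive; (ii) $\overline{R}\cup\overline{S}=X^2\setminus\mathcal{D}$; (iii) $\overline{R}\cap\overline{S}=\emptyset$; (iv) whenever $xSy$ and $yRz$ then $xRz$. -}

module Defs where

open import Data.Nat as ℕ using (ℕ; suc)
import Data.Nat.Properties as ℕP
open import Data.Integer as ℤ using (ℤ; +_; _-_)
open import Data.Fin using (Fin; toℕ)
open import Data.Product using (_×_; ∃-syntax)
open import Data.Sum using (_⊎_)
open import Relation.Nullary using (¬_; yes; no)
open import Relation.Binary.PropositionalEquality using (_≡_; _≢_)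
open import Function.Bundles using (_⇔_)
open import Data.Empty using (⊥)

Rel : Set → Set₁
Rel X = X → X → Set

Irreflexive : {X : Set} → Rel X → Set
Irreflexive θ = ∀ x → ¬ θ x x

Transitive : {X : Set} → Rel X → Set
Transitive θ = ∀ x y z → θ x y → θ y z → θ x z

Sym : {X : Set} → Rel X → Rel X
Sym θ x y = θ x y ⊎ θ y x

record IsCatalanPair {X : Set} (S R : Rel X) : Set where
  field
    S-irrefl : Irreflexive S
    S-trans  : Transitive S
    R-irrefl : Irreflexive R
    R-trans  : Transitive R
    cover    : ∀ x y → ((Sym R x y ⊎ Sym S x y) ⇔ (x ≢ y))
    disjoint : ∀ x y → Sym R x y → Sym S x y → ⊥
    compat   : ∀ x y z → S x y → R y z → R x z

-- The sequence: positions are i : Fin n, with 1-based index  idx i = toℕ i + 1.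

idx : {n : ℕ} → Fin n → ℕ
idx i = suc (toℕ i)

_<ᵢ_ : {n : ℕ} → Fin n → Fin n → Set
i <ᵢ j = toℕ i ℕ.< toℕ j

_≤ᵢ_ : {n : ℕ} → Fin n → Fin n → Set
i ≤ᵢ j = toℕ i ℕ.≤ toℕ j

InRange : (n : ℕ) → (Fin n → ℕ) → Set
InRange n a = ∀ i → (1 ℕ.≤ a i) × (a i ℕ.≤ n)

Nondecreasing : (n : ℕ) → (Fin n → ℕ) → Set
Nondecreasing n a = ∀ i j → i ≤ᵢ j → a i ℕ.≤ a j

UniqueFixed : (n : ℕ) → (Fin n → ℕ) → Fin n → Set
UniqueFixed n a f = (a f ≡ idx f) × (∀ g → a g ≡ idx g → g ≡ f)

a′ : {n : ℕ} → (Fin n → ℕ) → Fin n → Fin n → ℤ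
a′ a f y with toℕ y ℕP.≤? toℕ f
... | yes _ = + a y - + idx y
... | no  _ = + idx y - + a y

data S-rel {n : ℕ} (a : Fin n → ℕ) (f : Fin n) : Fin n → Fin n → Set where
  S-a : ∀ {i j} → i ≤ᵢ f → j ≤ᵢ f → i <ᵢ j →
        a′ a f j ℤ.< a′ a f i →
        (∀ k → i <ᵢ k → k ≤ᵢ f → a′ a f k ≡ a′ a f j → j ≤ᵢ k) →
        S-rel a f i j
  S-c : ∀ {i j} → f <ᵢ i → f <ᵢ j → i <ᵢ j →
        a′ a f i ℤ.< a′ a f j →
        (∀ k → f <ᵢ k → k <ᵢ j → a′ a f k ≡ a′ a f i → k ≤ᵢ i) →
        S-rel a f j i

data R-rel {n : ℕ} (a : Fin n → ℕ) (f : Fin n) : Fin n → Fin n → Set where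
  R-a : ∀ {i j} → i ≤ᵢ f → j ≤ᵢ f → i <ᵢ j →
        ((a′ a f j ℤ.< a′ a f i) × (∃[ w ] (i <ᵢ w × w <ᵢ j × a′ a f w ≡ a′ a f j)))
        ⊎ (a′ a f i ℤ.≤ a′ a f j) →
        R-rel a f i j
  R-b : ∀ {i j} → i ≤ᵢ f → f <ᵢ j → R-rel a f i j
  R-c : ∀ {i j} → f <ᵢ i → f <ᵢ j → i <ᵢ j →
        ((a′ a f i ℤ.< a′ a f j) × (∃[ w ] (i <ᵢ w × w <ᵢ j × a′ a f w ≡ a′ a f i)))
        ⊎ (a′ a f j ℤ.≤ a′ a f i) →
        R-rel a f i j

module Submission where

-- The relations S and R only ever compare positions by their index and by the
-- value b = a′ a f.  Write c i = aᵢ − i.  Then b = c on the left block (i ≤ f)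
-- and b = −c on the right block (i > f), and since a is nondecreasing, c never
-- drops by more than one from one index to the next.  A discrete intermediate
-- value theorem therefore applies to b on each block: any value strictly
-- between b at two positions of the same block is attained strictly between
-- them.  This single fact is what the minimality/maximality clauses of S and
-- the "repeated value" clauses of R need.

open import Defs
open import Data.Nat as ℕ using (ℕ; suc; _≤′_; ≤′-refl; ≤′-step)
import Data.Nat.Properties as ℕP
open import Data.Integer as ℤ using (ℤ; +_; _-_; 0ℤ; 1ℤ; +≤+)
import Data.Integer.Properties as ℤP
open import Data.Integer.Tactic.RingSolver using (solve-∀)
open import Data.Fin using (Fin; toℕ; fromℕ<)
open import Data.Fin.Properties using (toℕ-injective; toℕ<n; toℕ-fromℕ<; fromℕ<-toℕ; fromℕ<-cong; any?)
open import Data.Product using (_×_; _,_; ∃-syntax)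
open import Data.Sum using (_⊎_; inj₁; inj₂)
import Data.Sum as Sum
open import Data.Empty using (⊥; ⊥-elim)
open import Relation.Nullary using (¬_; Dec; yes; no)
open import Relation.Nullary.Decidable using (_×-dec_)
open import Relation.Binary using (tri<; tri≈; tri>)
open import Relation.Binary.PropositionalEquality
open import Function.Bundles using (mk⇔)

SlowlyDescending : (ℕ → ℤ) → ℕ → Set
SlowlyDescending g hi = ∀ k → k ℕ.< hi → g k ℤ.≤ ℤ.suc (g (suc k))

-- The recursion walks
-- down from hi: if g hi ≠ v then g hi < v, hence g (hi − 1) ≤ g hi + 1 ≤ v.
discrete-ivt : (g : ℕ → ℤ) {lo hi : ℕ} {v : ℤ} → lo ≤′ hi → SlowlyDescending g hi →
               g hi ℤ.≤ v → v ℤ.≤ g lo → ∃[ m ] (lo ℕ.≤ m × m ℕ.≤ hi × g m ≡ v)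
discrete-ivt g {lo} ≤′-refl slow hi≤v v≤lo = lo , ℕP.≤-refl , ℕP.≤-refl , ℤP.≤-antisym hi≤v v≤lo
discrete-ivt g {hi = suc h} {v} (≤′-step lo≤′h) slow hi≤v v≤lo with g (suc h) ℤP.≟ v
... | yes hi≡v = suc h , ℕP.≤′⇒≤ (≤′-step lo≤′h) , ℕP.≤-refl , hi≡v
... | no  hi≢v =
  let m , lo≤m , m≤h , m≡v = discrete-ivt g lo≤′h below-h h≤v v≤lo
  in  m , lo≤m , ℕP.m≤n⇒m≤1+n m≤h , m≡v
  where
    below-h : SlowlyDescending g h
    below-h k k<h = slow k (ℕP.m<n⇒m<1+n k<h)
    h≤v : g h ℤ.≤ v
    h≤v = ℤP.≤-trans (slow h (ℕP.n<1+n h)) (ℤP.i<j⇒suc[i]≤j (ℤP.≤∧≢⇒< hi≤v hi≢v))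

strict-ivt : (g : ℕ → ℤ) {lo hi : ℕ} {v : ℤ} → lo ℕ.< hi → SlowlyDescending g hi →
             g hi ℤ.< v → v ℤ.< g lo → ∃[ m ] (lo ℕ.< m × m ℕ.< hi × g m ≡ v)
strict-ivt g lo<hi slow hi<v v<lo =
  let m , lo≤m , m≤hi , m≡v = discrete-ivt g (ℕP.≤⇒≤′ (ℕP.<⇒≤ lo<hi)) slow (ℤP.<⇒≤ hi<v) (ℤP.<⇒≤ v<lo)
  in  m , ℕP.≤∧≢⇒< lo≤m (λ lo≡m → ℤP.<-irrefl (sym (trans (cong g lo≡m) m≡v)) v<lo)
        , ℕP.≤∧≢⇒< m≤hi (λ m≡hi → ℤP.<-irrefl (trans (cong g (sym m≡hi)) m≡v) hi<v)
        , m≡v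

minus-suc : ∀ x y → 1ℤ ℤ.+ (x - (1ℤ ℤ.+ y)) ≡ x - y
minus-suc = solve-∀

neg-minus : ∀ x y → y - x ≡ ℤ.- (x - y)
neg-minus = solve-∀

neg-swapʳ : ∀ {x y} → x ℤ.< ℤ.- y → y ℤ.< ℤ.- x
neg-swapʳ {x} {y} x<-y = subst (ℤ._< ℤ.- x) (ℤP.neg-involutive y) (ℤP.neg-mono-< x<-y)

neg-swapˡ : ∀ {x y} → ℤ.- y ℤ.< x → ℤ.- x ℤ.< y
neg-swapˡ {x} {y} -y<x = subst (ℤ.- x ℤ.<_) (ℤP.neg-involutive y) (ℤP.neg-mono-< -y<x)

module Sequence (n : ℕ) (a : Fin n → ℕ) (f : Fin n) (nd : Nondecreasing n a) where

  b : Fin n → ℤ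
  b = a′ a f

  S R : Rel (Fin n)
  S = S-rel a f
  R = R-rel a f

  c : Fin n → ℤ
  c i = + a i - + idx i

  c-slow : ∀ i j → toℕ j ≡ suc (toℕ i) → c i ℤ.≤ ℤ.suc (c j)
  c-slow i j j≡1+i = begin
    + a i - + idx i          ≤⟨ ℤP.+-monoˡ-≤ (ℤ.- + idx i) (+≤+ (nd i j i≤j)) ⟩
    + a j - + idx i          ≡⟨ minus-suc (+ a j) (+ idx i) ⟨
    ℤ.suc (+ a j - + suc (idx i)) ≡⟨ cong (λ t → ℤ.suc (+ a j - + suc t)) (sym j≡1+i) ⟩
    ℤ.suc (c j)              ∎
    where
      open ℤP.≤-Reasoning
      i≤j : i ≤ᵢ j
      i≤j = ℕP.≤-trans (ℕP.n≤1+n _) (ℕP.≤-reflexive (sym j≡1+i))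

  -- c read as an ℕ-indexed sequence (its values at indices ≥ n are irrelevant)
  cℕ : ℕ → ℤ
  cℕ k with k ℕ.<? n
  ... | yes k<n = c (fromℕ< k<n)
  ... | no  _   = 0ℤ

  cℕ-fromℕ< : ∀ {k} (k<n : k ℕ.< n) → cℕ k ≡ c (fromℕ< k<n)
  cℕ-fromℕ< {k} k<n with k ℕ.<? n
  ... | yes k<n′ = cong c (fromℕ<-cong k k refl k<n′ k<n)
  ... | no  k≮n  = ⊥-elim (k≮n k<n)

  cℕ-toℕ : ∀ i → cℕ (toℕ i) ≡ c i
  cℕ-toℕ i = trans (cℕ-fromℕ< (toℕ<n i)) (cong c (fromℕ<-toℕ i (toℕ<n i)))

  cℕ-slow : ∀ k → suc k ℕ.< n → cℕ k ℤ.≤ ℤ.suc (cℕ (suc k))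
  cℕ-slow k 1+k<n
    rewrite cℕ-fromℕ< (ℕP.<-trans (ℕP.n<1+n k) 1+k<n) | cℕ-fromℕ< 1+k<n
    = c-slow _ _ (trans (toℕ-fromℕ< 1+k<n) (cong suc (sym (toℕ-fromℕ< _))))

  ivt-c : ∀ {lo hi v} → lo <ᵢ hi → c hi ℤ.< v → v ℤ.< c lo →
          ∃[ m ] (lo <ᵢ m × m <ᵢ hi × c m ≡ v)
  ivt-c {lo} {hi} lo<hi hi<v v<lo =
    let k , lo<k , k<hi , k≡v = strict-ivt cℕ lo<hi slow
                                  (subst (ℤ._< _) (sym (cℕ-toℕ hi)) hi<v)
                                  (subst (_ ℤ.<_) (sym (cℕ-toℕ lo)) v<lo)
        k<n = ℕP.<-trans k<hi (toℕ<n hi)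
        toℕ-m = toℕ-fromℕ< k<n
    in  fromℕ< k<n
      , subst (toℕ lo ℕ.<_) (sym toℕ-m) lo<k
      , subst (ℕ._< toℕ hi) (sym toℕ-m) k<hi
      , trans (sym (cℕ-fromℕ< k<n)) k≡v
    where
      slow : SlowlyDescending cℕ (toℕ hi)
      slow k k<hi = cℕ-slow k (ℕP.≤-<-trans k<hi (toℕ<n hi))

  b-left : ∀ {i} → i ≤ᵢ f → b i ≡ c i
  b-left {i} i≤f with toℕ i ℕP.≤? toℕ f
  ... | yes _   = refl
  ... | no  i≰f = ⊥-elim (i≰f i≤f)

  b-right : ∀ {i} → f <ᵢ i → b i ≡ ℤ.- c i
  b-right {i} f<i with toℕ i ℕP.≤? toℕ f
  ... | yes i≤f = ⊥-elim (ℕP.<⇒≱ f<i i≤f)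
  ... | no  _   = neg-minus (+ a i) (+ idx i)

  Repeated : Fin n → Fin n → ℤ → Set
  Repeated i j v = ∃[ w ] (i <ᵢ w × w <ᵢ j × b w ≡ v)

  ivt-left : ∀ {lo hi v} → lo <ᵢ hi → hi ≤ᵢ f → b hi ℤ.< v → v ℤ.< b lo → Repeated lo hi v
  ivt-left lo<hi hi≤f hi<v v<lo =
    let m , lo<m , m<hi , m≡v = ivt-c lo<hi (subst (ℤ._< _) (b-left hi≤f) hi<v)
                                        (subst (_ ℤ.<_) (b-left (left lo<hi)) v<lo)
    in  m , lo<m , m<hi , trans (b-left (left m<hi)) m≡v
    where
      left : ∀ {i} → i <ᵢ _ → i ≤ᵢ f
      left i<hi = ℕP.<⇒≤ (ℕP.<-≤-trans i<hi hi≤f)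

  ivt-right : ∀ {lo hi v} → f <ᵢ lo → lo <ᵢ hi → b lo ℤ.< v → v ℤ.< b hi → Repeated lo hi v
  ivt-right {lo} {v = v} f<lo lo<hi lo<v v<hi =
    let m , lo<m , m<hi , m≡-v = ivt-c lo<hi (neg-swapʳ (subst (_ ℤ.<_) (b-right (right lo<hi)) v<hi))
                                              (neg-swapˡ (subst (ℤ._< _) (b-right f<lo) lo<v))
    in  m , lo<m , m<hi
      , trans (b-right (right lo<m)) (trans (cong ℤ.-_ m≡-v) (ℤP.neg-involutive v))
    where
      right : ∀ {i} → lo <ᵢ i → f <ᵢ i
      right lo<i = ℕP.<-trans f<lo lo<i

  FirstAfter : Fin n → Fin n → Set
  FirstAfter i j = ∀ k → i <ᵢ k → k ≤ᵢ f → b k ≡ b j → j ≤ᵢ k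

  LastBefore : Fin n → Fin n → Set
  LastBefore i j = ∀ k → f <ᵢ k → k <ᵢ j → b k ≡ b i → k ≤ᵢ i

  RLeft : Fin n → Fin n → Set
  RLeft i j = ((b j ℤ.< b i) × Repeated i j (b j)) ⊎ (b i ℤ.≤ b j)

  RRight : Fin n → Fin n → Set
  RRight i j = ((b i ℤ.< b j) × Repeated i j (b i)) ⊎ (b j ℤ.≤ b i)

  block-clash : ∀ {i} → f <ᵢ i → i ≤ᵢ f → ⊥
  block-clash = ℕP.<⇒≱

  repeat-before-first : ∀ {i j k} → FirstAfter i j → j ≤ᵢ f → i <ᵢ k → k <ᵢ j → b k ≡ b j → ⊥
  repeat-before-first first j≤f i<k k<j k≡j =
    ℕP.<⇒≱ k<j (first _ i<k (ℕP.<⇒≤ (ℕP.<-≤-trans k<j j≤f)) k≡j)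

  repeat-after-last : ∀ {i j k} → LastBefore i j → f <ᵢ i → i <ᵢ k → k <ᵢ j → b k ≡ b i → ⊥
  repeat-after-last last f<i i<k k<j k≡i = ℕP.<⇒≱ i<k (last _ (ℕP.<-trans f<i i<k) k<j k≡i)

  first-if-unrepeated : ∀ {i j} → ¬ Repeated i j (b j) → FirstAfter i j
  first-if-unrepeated {i} {j} none k i<k _ k≡j with toℕ j ℕP.≤? toℕ k
  ... | yes j≤k = j≤k
  ... | no  j≰k = ⊥-elim (none (k , i<k , ℕP.≰⇒> j≰k , k≡j))

  last-if-unrepeated : ∀ {i j} → ¬ Repeated i j (b i) → LastBefore i j
  last-if-unrepeated {i} {j} none k _ k<j k≡i with toℕ k ℕP.≤? toℕ i
  ... | yes k≤i = k≤i
  ... | no  k≰i = ⊥-elim (none (k , ℕP.≰⇒> k≰i , k<j , k≡i))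

  repeated? : ∀ i j v → Dec (Repeated i j v)
  repeated? i j v = any? (λ w → (toℕ i ℕP.<? toℕ w) ×-dec (toℕ w ℕP.<? toℕ j) ×-dec (b w ℤP.≟ v))

  same-value : ∀ {i j} → toℕ i ≡ toℕ j → b i ≡ b j
  same-value i≡j = cong b (toℕ-injective i≡j)

  -- Transitivity of S on the left block: "first after" composes, because a
  -- repetition of b z before y would, by the intermediate value theorem, force
  -- a repetition of b y before y.
  first-trans : ∀ {x y z} → x <ᵢ y → y ≤ᵢ f → b z ℤ.< b y → b y ℤ.< b x →
                FirstAfter x y → FirstAfter y z → FirstAfter x z
  first-trans {x} {y} {z} x<y y≤f z<y y<x first-y first-z k x<k k≤f k≡z
    with ℕP.<-cmp (toℕ y) (toℕ k)
  ... | tri< y<k _ _ = first-z k y<k k≤f k≡z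
  ... | tri≈ _ y≡k _ = ⊥-elim (ℤP.<-irrefl (trans (sym k≡z) (same-value (sym y≡k))) z<y)
  ... | tri> _ _ k<y =
    let m , x<m , m<k , m≡y = ivt-left x<k k≤f (subst (ℤ._< b y) (sym k≡z) z<y) y<x
    in  ⊥-elim (repeat-before-first first-y y≤f x<m (ℕP.<-trans m<k k<y) m≡y)

  last-trans : ∀ {x y z} → f <ᵢ y → y <ᵢ x → b z ℤ.< b y → b y ℤ.< b x →
               LastBefore y x → LastBefore z y → LastBefore z x
  last-trans {x} {y} {z} f<y y<x z<y y<x′ last-y last-z k f<k k<x k≡z
    with ℕP.<-cmp (toℕ k) (toℕ y)
  ... | tri< k<y _ _ = last-z k f<k k<y k≡z
  ... | tri≈ _ k≡y _ = ⊥-elim (ℤP.<-irrefl (trans (sym k≡z) (same-value k≡y)) z<y)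
  ... | tri> _ _ y<k =
    let m , k<m , m<x , m≡y = ivt-right f<k k<x (subst (ℤ._< b y) (sym k≡z) z<y) y<x′
    in  ⊥-elim (repeat-after-last last-y f<y (ℕP.<-trans y<k k<m) m<x m≡y)

  S-irreflexive : Irreflexive S
  S-irreflexive _ (S-a _ _ i<i _ _) = ℕP.<-irrefl refl i<i
  S-irreflexive _ (S-c _ _ i<i _ _) = ℕP.<-irrefl refl i<i

  S-transitive : Transitive S
  S-transitive x y z (S-a x≤f y≤f x<y y<x first-y) (S-a _ z≤f y<z z<y first-z) =
    S-a x≤f z≤f (ℕP.<-trans x<y y<z) (ℤP.<-trans z<y y<x) (first-trans {x} {y} {z} x<y y≤f z<y y<x first-y first-z)
  S-transitive x y z (S-a _ y≤f _ _ _) (S-c _ f<y _ _ _) = ⊥-elim (block-clash f<y y≤f)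
  S-transitive x y z (S-c f<y _ _ _ _) (S-a y≤f _ _ _ _) = ⊥-elim (block-clash f<y y≤f)
  S-transitive x y z (S-c f<y f<x y<x y<x′ last-y) (S-c f<z _ z<y z<y′ last-z) =
    S-c f<z f<x (ℕP.<-trans z<y y<x) (ℤP.<-trans z<y′ y<x′) (last-trans {x} {y} {z} f<y y<x z<y′ y<x′ last-y last-z)

  -- The R-clause on the left block extends backwards: if y R z then x R z
  -- for every earlier x.  (When b z < b x but b y ≤ b z, the value b z is
  -- attained between x and y by the intermediate value theorem.)
  extend-left : ∀ {x y z} → x <ᵢ y → y <ᵢ z → y ≤ᵢ f → RLeft y z → RLeft x z
  extend-left {x} {y} {z} x<y y<z y≤f D with b x ℤP.≤? b z
  ... | yes x≤z = inj₂ x≤z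
  ... | no  x≰z = inj₁ (z<x , repetition D)
    where
      z<x : b z ℤ.< b x
      z<x = ℤP.≰⇒> x≰z
      repetition : RLeft y z → Repeated x z (b z)
      repetition (inj₁ (_ , w , y<w , w<z , w≡z)) = w , ℕP.<-trans x<y y<w , w<z , w≡z
      repetition (inj₂ y≤z) with b y ℤP.≟ b z
      ... | yes y≡z = y , x<y , y<z , y≡z
      ... | no  y≢z =
        let m , x<m , m<y , m≡z = ivt-left x<y y≤f (ℤP.≤∧≢⇒< y≤z y≢z) z<x
        in  m , x<m , ℕP.<-trans m<y y<z , m≡z

  extend-right : ∀ {x y z} → x <ᵢ y → y <ᵢ z → f <ᵢ y → RRight x y → RRight x z
  extend-right {x} {y} {z} x<y y<z f<y D with b z ℤP.≤? b x
  ... | yes z≤x = inj₂ z≤x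
  ... | no  z≰x = inj₁ (x<z , repetition D)
    where
      x<z : b x ℤ.< b z
      x<z = ℤP.≰⇒> z≰x
      repetition : RRight x y → Repeated x z (b x)
      repetition (inj₁ (_ , w , x<w , w<y , w≡x)) = w , x<w , ℕP.<-trans w<y y<z , w≡x
      repetition (inj₂ y≤x) with b y ℤP.≟ b x
      ... | yes y≡x = y , x<y , y<z , y≡x
      ... | no  y≢x =
        let m , y<m , m<z , m≡x = ivt-right f<y y<z (ℤP.≤∧≢⇒< y≤x y≢x) x<z
        in  m , ℕP.<-trans x<y y<m , m<z , m≡x

  R-irreflexive : Irreflexive R
  R-irreflexive _ (R-a _ _ i<i _) = ℕP.<-irrefl refl i<i
  R-irreflexive _ (R-b i≤f f<i)   = block-clash f<i i≤f
  R-irreflexive _ (R-c _ _ i<i _) = ℕP.<-irrefl refl i<i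

  R-transitive : Transitive R
  R-transitive x y z (R-a x≤f y≤f x<y _) (R-a _ z≤f y<z D) =
    R-a x≤f z≤f (ℕP.<-trans x<y y<z) (extend-left x<y y<z y≤f D)
  R-transitive x y z (R-a x≤f _ _ _) (R-b _ f<z)       = R-b x≤f f<z
  R-transitive x y z (R-a _ y≤f _ _) (R-c f<y _ _ _)   = ⊥-elim (block-clash f<y y≤f)
  R-transitive x y z (R-b _ f<y) (R-a y≤f _ _ _)       = ⊥-elim (block-clash f<y y≤f)
  R-transitive x y z (R-b _ f<y) (R-b y≤f _)           = ⊥-elim (block-clash f<y y≤f)
  R-transitive x y z (R-b x≤f _) (R-c _ f<z _ _)       = R-b x≤f f<z
  R-transitive x y z (R-c _ f<y _ _) (R-a y≤f _ _ _)   = ⊥-elim (block-clash f<y y≤f)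
  R-transitive x y z (R-c _ f<y _ _) (R-b y≤f _)       = ⊥-elim (block-clash f<y y≤f)
  R-transitive x y z (R-c f<x f<y x<y D) (R-c _ f<z y<z _) =
    R-c f<x f<z (ℕP.<-trans x<y y<z) (extend-right x<y y<z f<y D)

  -- There x S y means y < x, b y < b x and
  -- y is the last index before x with value b y.  If moreover y R z, then z
  -- lies beyond x: otherwise b y would be repeated strictly between y and x.
  beyond-last : ∀ {x y z} → f <ᵢ y → f <ᵢ z → y <ᵢ x → b y ℤ.< b x → LastBefore y x →
                y <ᵢ z → RRight y z → x <ᵢ z
  beyond-last {x} {y} {z} f<y f<z y<x y<x′ last y<z D with ℕP.<-cmp (toℕ x) (toℕ z) | D
  ... | tri< x<z _ _ | _ = x<z
  ... | tri≈ _ x≡z _ | inj₁ (_ , w , y<w , w<z , w≡y) =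
    ⊥-elim (repeat-after-last last f<y y<w (subst (toℕ w ℕ.<_) (sym x≡z) w<z) w≡y)
  ... | tri≈ _ x≡z _ | inj₂ z≤y =
    ⊥-elim (ℤP.<-irrefl refl (ℤP.≤-<-trans (ℤP.≤-trans (ℤP.≤-reflexive (same-value x≡z)) z≤y) y<x′))
  ... | tri> _ _ z<x | inj₁ (_ , w , y<w , w<z , w≡y) =
    ⊥-elim (repeat-after-last last f<y y<w (ℕP.<-trans w<z z<x) w≡y)
  ... | tri> _ _ z<x | inj₂ z≤y with b z ℤP.≟ b y
  ...   | yes z≡y = ⊥-elim (repeat-after-last last f<y y<z z<x z≡y)
  ...   | no  z≢y =
    let m , z<m , m<x , m≡y = ivt-right f<z z<x (ℤP.≤∧≢⇒< z≤y z≢y) y<x′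
    in  ⊥-elim (repeat-after-last last f<y (ℕP.<-trans y<z z<m) m<x m≡y)

  transfer-last : ∀ {x y z} → f <ᵢ y → y <ᵢ x → b y ℤ.< b x → LastBefore y x →
                  x <ᵢ z → RRight y z → RRight x z
  transfer-last {x} {y} {z} f<y y<x y<x′ last x<z D with b z ℤP.≤? b x
  ... | yes z≤x = inj₂ z≤x
  ... | no  z≰x = inj₁ (x<z′ , repetition D)
    where
      x<z′ : b x ℤ.< b z
      x<z′ = ℤP.≰⇒> z≰x
      repetition : RRight y z → Repeated x z (b x)
      repetition (inj₁ (_ , w , y<w , w<z , w≡y)) with ℕP.<-cmp (toℕ w) (toℕ x)
      ... | tri< w<x _ _ = ⊥-elim (repeat-after-last last f<y y<w w<x w≡y)
      ... | tri≈ _ w≡x _ = ⊥-elim (ℤP.<-irrefl (trans (sym w≡y) (same-value w≡x)) y<x′)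
      ... | tri> _ _ x<w =
        let m , w<m , m<z , m≡x = ivt-right (ℕP.<-trans f<y y<w) w<z (subst (ℤ._< b x) (sym w≡y) y<x′) x<z′
        in  m , ℕP.<-trans x<w w<m , m<z , m≡x
      repetition (inj₂ z≤y) = ⊥-elim (ℤP.<-irrefl refl (ℤP.≤-<-trans z≤y (ℤP.<-trans y<x′ x<z′)))

  compatible : ∀ x y z → S x y → R y z → R x z
  compatible x y z (S-a x≤f y≤f x<y _ _) (R-a _ z≤f y<z D) =
    R-a x≤f z≤f (ℕP.<-trans x<y y<z) (extend-left x<y y<z y≤f D)
  compatible x y z (S-a x≤f _ _ _ _) (R-b _ f<z)     = R-b x≤f f<z
  compatible x y z (S-a _ y≤f _ _ _) (R-c f<y _ _ _) = ⊥-elim (block-clash f<y y≤f)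
  compatible x y z (S-c f<y _ _ _ _) (R-a y≤f _ _ _) = ⊥-elim (block-clash f<y y≤f)
  compatible x y z (S-c f<y _ _ _ _) (R-b y≤f _)     = ⊥-elim (block-clash f<y y≤f)
  compatible x y z (S-c f<y f<x y<x y<x′ last) (R-c _ f<z y<z D) =
    let x<z = beyond-last f<y f<z y<x y<x′ last y<z D
    in  R-c f<x f<z x<z (transfer-last f<y y<x y<x′ last x<z D)

  not-R-and-S : ∀ {u v} → R u v → S u v → ⊥
  not-R-and-S (R-a _ v≤f _ (inj₁ (_ , w , u<w , w<v , w≡v))) (S-a _ _ _ _ first) =
    repeat-before-first first v≤f u<w w<v w≡v
  not-R-and-S (R-a _ _ _ (inj₂ u≤v)) (S-a _ _ _ v<u _) = ℤP.<⇒≱ v<u u≤v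
  not-R-and-S (R-a _ _ u<v _) (S-c _ _ v<u _ _)       = ℕP.<-asym u<v v<u
  not-R-and-S (R-b _ f<v) (S-a _ v≤f _ _ _)           = block-clash f<v v≤f
  not-R-and-S (R-b u≤f _) (S-c _ f<u _ _ _)           = block-clash f<u u≤f
  not-R-and-S (R-c f<u _ _ _) (S-a u≤f _ _ _ _)       = block-clash f<u u≤f
  not-R-and-S (R-c _ _ u<v _) (S-c _ _ v<u _ _)       = ℕP.<-asym u<v v<u

  not-R-and-S⁻¹ : ∀ {u v} → R u v → S v u → ⊥
  not-R-and-S⁻¹ (R-a _ _ u<v _) (S-a _ _ v<u _ _)     = ℕP.<-asym u<v v<u
  not-R-and-S⁻¹ (R-a u≤f _ _ _) (S-c f<u _ _ _ _)     = block-clash f<u u≤f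
  not-R-and-S⁻¹ (R-b _ f<v) (S-a v≤f _ _ _ _)         = block-clash f<v v≤f
  not-R-and-S⁻¹ (R-b u≤f _) (S-c f<u _ _ _ _)         = block-clash f<u u≤f
  not-R-and-S⁻¹ (R-c _ _ u<v _) (S-a _ _ v<u _ _)     = ℕP.<-asym u<v v<u
  not-R-and-S⁻¹ (R-c f<u _ _ (inj₁ (_ , w , u<w , w<v , w≡u))) (S-c _ _ _ _ last) =
    repeat-after-last last f<u u<w w<v w≡u
  not-R-and-S⁻¹ (R-c _ _ _ (inj₂ v≤u)) (S-c _ _ _ u<v _) = ℤP.<⇒≱ u<v v≤u

  disjoint : ∀ x y → Sym R x y → Sym S x y → ⊥
  disjoint x y (inj₁ r) (inj₁ s) = not-R-and-S r s
  disjoint x y (inj₁ r) (inj₂ s) = not-R-and-S⁻¹ r s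
  disjoint x y (inj₂ r) (inj₁ s) = not-R-and-S⁻¹ r s
  disjoint x y (inj₂ r) (inj₂ s) = not-R-and-S r s

  -- Outside the R-clauses, the missing repetition is exactly the
  -- minimality (left) or maximality (right) clause of S.
  related-left : ∀ {i j} → i ≤ᵢ f → j ≤ᵢ f → i <ᵢ j → R i j ⊎ S i j
  related-left {i} {j} i≤f j≤f i<j with b j ℤP.<? b i
  ... | no  j≮i = inj₁ (R-a i≤f j≤f i<j (inj₂ (ℤP.≮⇒≥ j≮i)))
  ... | yes j<i with repeated? i j (b j)
  ...   | yes rep  = inj₁ (R-a i≤f j≤f i<j (inj₁ (j<i , rep)))
  ...   | no  none = inj₂ (S-a i≤f j≤f i<j j<i (first-if-unrepeated none))

  related-right : ∀ {i j} → f <ᵢ i → f <ᵢ j → i <ᵢ j → R i j ⊎ S j i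
  related-right {i} {j} f<i f<j i<j with b i ℤP.<? b j
  ... | no  i≮j = inj₁ (R-c f<i f<j i<j (inj₂ (ℤP.≮⇒≥ i≮j)))
  ... | yes i<j′ with repeated? i j (b i)
  ...   | yes rep  = inj₁ (R-c f<i f<j i<j (inj₁ (i<j′ , rep)))
  ...   | no  none = inj₂ (S-c f<i f<j i<j i<j′ (last-if-unrepeated none))

  related : ∀ i j → i <ᵢ j → Sym R i j ⊎ Sym S i j
  related i j i<j with toℕ j ℕP.≤? toℕ f | toℕ i ℕP.≤? toℕ f
  ... | yes j≤f | _       = Sum.map inj₁ inj₁ (related-left (ℕP.≤-trans (ℕP.<⇒≤ i<j) j≤f) j≤f i<j)
  ... | no  j≰f | yes i≤f = inj₁ (inj₁ (R-b i≤f (ℕP.≰⇒> j≰f)))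
  ... | no  j≰f | no  i≰f = Sum.map inj₁ inj₂ (related-right (ℕP.≰⇒> i≰f) (ℕP.≰⇒> j≰f) i<j)

  cover : ∀ x y → x ≢ y → Sym R x y ⊎ Sym S x y
  cover x y x≢y with ℕP.<-cmp (toℕ x) (toℕ y)
  ... | tri< x<y _ _ = related x y x<y
  ... | tri≈ _ x≡y _ = ⊥-elim (x≢y (toℕ-injective x≡y))
  ... | tri> _ _ y<x = Sum.map Sum.swap Sum.swap (related y x y<x)

  distinct : ∀ x y → Sym R x y ⊎ Sym S x y → x ≢ y
  distinct x .x (inj₁ (inj₁ r)) refl = R-irreflexive x r
  distinct x .x (inj₁ (inj₂ r)) refl = R-irreflexive x r
  distinct x .x (inj₂ (inj₁ s)) refl = S-irreflexive x s
  distinct x .x (inj₂ (inj₂ s)) refl = S-irreflexive x s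

  catalan-pair : IsCatalanPair S R
  catalan-pair = record
    { S-irrefl = S-irreflexive ; S-trans = S-transitive
    ; R-irrefl = R-irreflexive ; R-trans = R-transitive
    ; cover    = λ x y → mk⇔ (distinct x y) (cover x y)
    ; disjoint = disjoint
    ; compat   = compatible
    }

proposition6 : (n : ℕ) (a : Fin n → ℕ) (f : Fin n) →
    InRange n a → Nondecreasing n a → UniqueFixed n a f →
    IsCatalanPair (S-rel a f) (R-rel a f)
proposition6 n a f _ nondecreasing _ = Sequence.catalan-pair n a f nondecreasing
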